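{- Let $n > 1$ be an integer, let $p$ be the largest prime factor of $n$, and let $P$ be the product of all (distinct) prime factors of $n$. Then $f(n) \geqslant \max\{(p-1)/2,\ n/P\}$.
   Context: For an integer $n>1$, $\mathcal{A}(n) = \{a \in \mathbb{Z}^{+} : a < n,\ \gcd(a,n)=1\}$, and $f(n)$ denotes the maximum possible length among all arithmetic progressions contained in $\mathcal{A}(n)$. An arithmetic progression of length $s$ is a sequence $a_0, a_0+q, \dots, a_0+(s-1)q$ of integers with common difference $q$ a positive integer. -}

module Defs where

open import Data.Nat using (ℕ; zero; suc; _+_; _*_; _≤_; _<_)
open import Data.Nat.Coprimality using (Coprime)
open import Data.Nat.Divisibility using (_∣?_)
open import Data.Nat.Primality using (prime?)
open import Data.List using (List; filter; upTo)
open import Data.Nat.ListAction using (product)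
open import Data.Product using (Σ; _×_)
open import Relation.Nullary.Decidable using (_×-dec_)

InA : ℕ → ℕ → Set
InA n a = (0 < a) × (a < n) × Coprime a n

APin : ℕ → (a₀ q s : ℕ) → Set
APin n a₀ q s = (1 ≤ q) × (∀ i → i < s → InA n (a₀ + i * q))

HasAP : ℕ → ℕ → Set
HasAP n s = Σ ℕ λ a₀ → Σ ℕ λ q → APin n a₀ q s

IsF : ℕ → ℕ → Set
IsF n m = HasAP n m × (∀ s → HasAP n s → s ≤ m)

rad : ℕ → ℕ
rad n = product (filter (λ q → prime? q ×-dec (q ∣? n)) (upTo (suc n)))

{-# OPTIONS --safe #-}
-- Every prime divisor of n divides R = rad n, so 1, 1 + R, …, 1 + m R are units
-- mod n; maximality of m = f(n) forces 1 + m R ≥ n, and equality is impossible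
-- because p ∣ n while p ∤ 1 + m R.  Writing n = d p, the numbers 1 + k d (k < p)
-- are all units mod n except for the at most one k solving 1 + k d ≡ 0 (mod p);
-- removing it splits the progression into two pieces of total length p − 1.
module Submission where

open import Defs
open import Data.Nat using (ℕ; zero; suc; _+_; _*_; _∸_; _≤_; _<_; _<?_; z≤n; s≤s; NonZero; >-nonZero; >-nonZero⁻¹; ≢-nonZero; ≢-nonZero⁻¹)
open import Data.Nat.Properties
open import Data.Nat.Coprimality using (Coprime)
open import Data.Nat.Divisibility using (_∣_; _∣?_; divides; ∣-trans; ∣m+n∣m⇒∣n; ∣n⇒∣m*n; n∣m*n; ∣⇒≤; ∣1⇒≡1; 0∣⇒≡0)
open import Data.Nat.Primality using (Prime; prime?; euclidsLemma; prime⇒irreducible; prime⇒nonZero; ¬prime[1]; productOfPrimes≥1)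
open import Data.Nat.Primality.Factorisation using (factorise; PrimeFactorisation)
open import Data.Nat.ListAction.Properties using (∈⇒∣product)
open import Data.List using ([]; _∷_; upTo)
open import Data.List.Relation.Unary.Any using (here)
import Data.List.Relation.Unary.All as All
open import Data.List.Relation.Unary.All.Properties using (all-filter)
open import Data.List.Membership.Propositional.Properties using (∈-filter⁺; ∈-upTo⁺)
open import Data.Product using (∃; _×_; _,_; proj₁)
open import Data.Sum using (inj₁; inj₂)
open import Relation.Nullary using (¬_; yes; no; contradiction)
open import Relation.Nullary.Decidable using (_×-dec_)
open import Function.Base using (it)
open import Relation.Binary using (tri<; tri≈; tri>)
open import Relation.Binary.PropositionalEquality using (_≡_; _≢_; refl; sym; trans; cong; subst; module ≡-Reasoning)

prime∤1 : ∀ {r} → Prime r → ¬ r ∣ 1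
prime∤1 pr r∣1 = ¬prime[1] (subst Prime (∣1⇒≡1 r∣1) pr)

prime∣m⇒∤1+k*m : ∀ {r m} k → Prime r → r ∣ m → ¬ r ∣ 1 + k * m
prime∣m⇒∤1+k*m {r} {m} k pr r∣m r∣1+km =
  prime∤1 pr (∣m+n∣m⇒∣n (subst (r ∣_) (+-comm 1 (k * m)) r∣1+km) (∣n⇒∣m*n k r∣m))

coprime-byPrimes : ∀ {a n} .{{_ : NonZero n}} → (∀ r → Prime r → r ∣ a → ¬ r ∣ n) → Coprime a n
coprime-byPrimes {a} {n} noCommonPrime {d} (d∣a , d∣n) = divisor≡1 (factorise d {{d≢0}})
  where
  d≢0 : NonZero d
  d≢0 = ≢-nonZero λ { refl → ≢-nonZero⁻¹ n (0∣⇒≡0 d∣n) }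
  divisor≡1 : PrimeFactorisation d → d ≡ 1
  divisor≡1 record { factors = [] ; isFactorisation = d≡1 } = d≡1
  divisor≡1 record { factors = r ∷ rs ; isFactorisation = d≡∏ ; factorsPrime = pr All.∷ _ } =
    contradiction (∣-trans r∣d d∣n) (noCommonPrime r pr (∣-trans r∣d d∣a))
    where
    r∣d : r ∣ d
    r∣d = subst (r ∣_) (sym d≡∏) (∈⇒∣product {ns = r ∷ rs} (here refl))

no-two-roots : ∀ {p d k k′} → Prime p → k < k′ → k′ < p → p ∣ 1 + k * d → ¬ p ∣ 1 + k′ * d
no-two-roots {p} {d} {k} {k′} pp k<k′ k′<p p∣1+kd p∣1+k′d with euclidsLemma (k′ ∸ k) d pp p∣gap
  where
  open ≡-Reasoning
  split : 1 + k′ * d ≡ (1 + k * d) + (k′ ∸ k) * d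
  split = begin
    1 + k′ * d                ≡⟨ cong (λ x → 1 + x * d) (sym (m+[n∸m]≡n (<⇒≤ k<k′))) ⟩
    1 + (k + (k′ ∸ k)) * d    ≡⟨ cong (1 +_) (*-distribʳ-+ d k (k′ ∸ k)) ⟩
    (1 + k * d) + (k′ ∸ k) * d ∎
  p∣gap : p ∣ (k′ ∸ k) * d
  p∣gap = ∣m+n∣m⇒∣n (subst (p ∣_) split p∣1+k′d) p∣1+kd
... | inj₁ p∣k′∸k = <⇒≱ k′<p (≤-trans (∣⇒≤ {{>-nonZero (m<n⇒0<n∸m k<k′)}} p∣k′∸k) (m∸n≤m k′ k))
... | inj₂ p∣d    = prime∣m⇒∤1+k*m k pp p∣d p∣1+kd

roots-unique : ∀ {p d k k′} → Prime p → k < p → k′ < p → p ∣ 1 + k * d → p ∣ 1 + k′ * d → k ≡ k′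
roots-unique {k = k} {k′} pp k<p k′<p p∣1+kd p∣1+k′d with <-cmp k k′
... | tri< k<k′ _ _ = contradiction p∣1+k′d (no-two-roots pp k<k′ k′<p p∣1+kd)
... | tri≈ _ k≡k′ _ = k≡k′
... | tri> _ _ k′<k = contradiction p∣1+kd (no-two-roots pp k′<k k<p p∣1+k′d)

at-most-one-root : ∀ {p} d → Prime p → ∃ λ i → ∀ k → k < p → k ≢ i → ¬ p ∣ 1 + k * d
at-most-one-root {p} d pp with anyUpTo? (λ k → p ∣? 1 + k * d) p
... | yes (i , i<p , p∣1+id) = i , λ k k<p k≢i p∣1+kd → k≢i (roots-unique pp k<p i<p p∣1+kd p∣1+id)
... | no noRoot              = p , λ k k<p _ p∣1+kd → noRoot (k , k<p , p∣1+kd)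

progression-with-hole : ∀ {n m a q L} i → IsF n m → 1 ≤ q
  → (∀ k → k < L → k ≢ i → InA n (a + k * q)) → L ∸ 1 ≤ 2 * m
progression-with-hole {n} {m} {a} {q} {L} i (_ , maximal) q≥1 inA with i <? L
... | no i≮L = ≤-trans (m∸n≤m L 1) (≤-trans (maximal L whole) (m≤m+n m _))
  where
  whole : HasAP n L
  whole = a , q , q≥1 , λ k k<L → inA k k<L λ { refl → i≮L k<L }
... | yes i<L = begin
  L ∸ 1           ≡⟨ L∸1≡i+rest ⟩
  i + (L ∸ suc i) ≤⟨ +-mono-≤ (maximal i before) (maximal (L ∸ suc i) after) ⟩
  m + m           ≡⟨ cong (m +_) (sym (+-identityʳ m)) ⟩
  2 * m           ∎
  where
  open ≤-Reasoning
  L∸1≡i+rest : L ∸ 1 ≡ i + (L ∸ suc i)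
  L∸1≡i+rest = sym (trans (cong (i +_) (sym (∸-+-assoc L 1 i))) (m+[n∸m]≡n (∸-monoˡ-≤ 1 i<L)))
  before : HasAP n i
  before = a , q , q≥1 , λ k k<i → inA k (<-trans k<i i<L) (<⇒≢ k<i)
  shift : ∀ j → a + (suc i + j) * q ≡ (a + suc i * q) + j * q
  shift j = trans (cong (a +_) (*-distribʳ-+ q (suc i) j)) (sym (+-assoc a _ _))
  after : HasAP n (L ∸ suc i)
  after = a + suc i * q , q , q≥1 , λ j j<rest →
    subst (InA n) (shift j)
      (inA (suc i + j)
           (subst (suc i + j <_) (m+[n∸m]≡n i<L) (+-monoʳ-< (suc i) j<rest))
           (λ eq → <⇒≢ (s≤s (m≤m+n i j)) (sym eq)))

1+k*d∈𝒜[d*p] : ∀ {d p k} .{{_ : NonZero d}} → Prime p → k < p → ¬ p ∣ 1 + k * d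
  → InA (d * p) (1 + k * d)
1+k*d∈𝒜[d*p] {d} {p} {k} pp k<p p∤1+kd =
  s≤s z≤n , ≤∧≢⇒< bounded (λ eq → p∤1+kd (subst (p ∣_) (sym eq) (n∣m*n d))) ,
  coprime-byPrimes {{m*n≢0 d p {{it}} {{prime⇒nonZero pp}}}} noCommonPrime
  where
  open ≤-Reasoning
  bounded : 1 + k * d ≤ d * p
  bounded = begin
    1 + k * d ≤⟨ +-monoˡ-≤ (k * d) (>-nonZero⁻¹ d) ⟩
    suc k * d ≤⟨ *-monoˡ-≤ d k<p ⟩
    p * d     ≡⟨ *-comm p d ⟩
    d * p     ∎
  noCommonPrime : ∀ r → Prime r → r ∣ 1 + k * d → ¬ r ∣ d * p
  noCommonPrime r pr r∣1+kd r∣dp with euclidsLemma d p pr r∣dp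
  ... | inj₁ r∣d = prime∣m⇒∤1+k*m k pr r∣d r∣1+kd
  ... | inj₂ r∣p with prime⇒irreducible pp r∣p
  ...   | inj₁ refl = ¬prime[1] pr
  ...   | inj₂ refl = p∤1+kd r∣1+kd

p∸1≤2*f : ∀ {d p m} .{{_ : NonZero d}} → IsF (d * p) m → Prime p → p ∸ 1 ≤ 2 * m
p∸1≤2*f {d} isF pp with at-most-one-root d pp
... | i , onlyRoot = progression-with-hole i isF (>-nonZero⁻¹ d) λ k k<p k≢i →
  1+k*d∈𝒜[d*p] pp k<p (onlyRoot k k<p k≢i)

prime∣n⇒∣rad : ∀ {n r} .{{_ : NonZero n}} → Prime r → r ∣ n → r ∣ rad n
prime∣n⇒∣rad {n} pr r∣n =
  ∈⇒∣product (∈-filter⁺ (λ q → prime? q ×-dec (q ∣? n)) (∈-upTo⁺ (s≤s (∣⇒≤ r∣n))) (pr , r∣n))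

rad≥1 : ∀ n → 1 ≤ rad n
rad≥1 n = productOfPrimes≥1 (All.map proj₁ (all-filter (λ q → prime? q ×-dec (q ∣? n)) (upTo (suc n))))

1+k*rad∈𝒜 : ∀ {n k} .{{_ : NonZero n}} → 1 + k * rad n < n → InA n (1 + k * rad n)
1+k*rad∈𝒜 {k = k} 1+kR<n = s≤s z≤n , 1+kR<n ,
  coprime-byPrimes λ r pr r∣1+kR r∣n → prime∣m⇒∤1+k*m k pr (prime∣n⇒∣rad pr r∣n) r∣1+kR

n≤f*rad : ∀ {n m p} .{{_ : NonZero n}} → IsF n m → Prime p → p ∣ n → n ≤ m * rad n
n≤f*rad {n} {m} {p} (_ , maximal) pp p∣n = ≤-pred (≤∧≢⇒< n≤1+mR n≢1+mR)
  where
  n≤1+mR : n ≤ 1 + m * rad n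
  n≤1+mR = ≮⇒≥ λ 1+mR<n → 1+n≰n (maximal (suc m) (1 , rad n , rad≥1 n , λ k k≤m →
    1+k*rad∈𝒜 {k = k} (≤-<-trans (+-monoʳ-≤ 1 (*-monoˡ-≤ (rad n) (≤-pred k≤m))) 1+mR<n)))
  n≢1+mR : n ≢ 1 + m * rad n
  n≢1+mR eq = prime∣m⇒∤1+k*m m pp (prime∣n⇒∣rad pp p∣n) (subst (p ∣_) eq p∣n)

-- Both bounds hold for every prime divisor p.
lemma2p1 : ∀ (n p m : ℕ) → 1 < n → Prime p → p ∣ n
    → (∀ q → Prime q → q ∣ n → q ≤ p)
    → IsF n m
    → (p ∸ 1 ≤ 2 * m) × (n ≤ m * rad n)
lemma2p1 _ p m () pp (divides zero refl) _ isF
lemma2p1 _ p m _ pp p∣n@(divides (suc d) refl) _ isF =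
  p∸1≤2*f {suc d} isF pp , n≤f*rad {{m*n≢0 (suc d) p {{_}} {{prime⇒nonZero pp}}}} isF pp p∣n
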